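{- Let $n\ge2$, let $a_1\cdots a_{n-1}$ be a word with $1\le a_i\le 2i-1$, and let $k$ be the least index $k'\in\{2,\ldots,n-1\}$ such that $a_j\ge 2k'-1$ for all $j\in\{k',\ldots,n-1\}$, if such an index exists, and $k=n$ otherwise. Then $\pi(a_1\cdots a_{k-1})$ is the first sign-connected component of the standard permutation $\pi(a_1\cdots a_{n-1})$.
   Context: A standard permutation of $\{\pm1,\ldots,\pm p\}$ is a word in which each element appears exactly once, $i$ occurs before $-i$ for each $i$, and the negative entries occur in the order $-1,\ldots,-p$. For a word $a_1\cdots a_p$ with $1\le a_i\le 2i-1$, $\pi(a_1\cdots a_p)$ is defined recursively: $\pi(a_1)=(1,-1)$, and for $p\ge2$, $\pi(a_1\cdots a_p)$ is obtained from $\pi(a_1\cdots a_{p-1})$ (length $2p-2$) by inserting $p$ so that it occupies position $a_p$ and then appending $-p$ at the end. For a standard permutation $\sigma$ of $\{\pm1,\ldots,\pm p\}$, let $2q$ be the least positive integer $t$ such that $\{\sigma(1),\ldots,\sigma(t)\}$ is a union of pairs $\{j,-j\}$; then $\sigma(1)\cdots\sigma(2q)$ is a standard permutation of $\{\pm1,\ldots,\pm q\}$, called the first sign-connected component of $\sigma$. -}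

module Defs where

open import Data.Nat using (ℕ; zero; suc; _∸_; _*_; _≤_; _<_)
open import Data.Integer using (ℤ; +_; -_)
open import Data.List using (List; []; _∷_; _++_; [_]; take; drop; length)
open import Data.List.Membership.Propositional using (_∈_)
open import Data.Product using (Σ; _×_; _,_)
open import Data.Sum using (_⊎_)
open import Relation.Nullary using (¬_)
open import Relation.Binary.PropositionalEquality using (_≡_)

-- 1-indexed entry a_j of a word (0 outside the range 1..length)
entry : List ℕ → ℕ → ℕ
entry []       _             = 0
entry (x ∷ xs) zero          = 0
entry (x ∷ xs) (suc zero)    = x
entry (x ∷ xs) (suc (suc j)) = entry xs (suc j)

ValidWord : List ℕ → Set
ValidWord w = ∀ i → 1 ≤ i → i ≤ length w → 1 ≤ entry w i × entry w i ≤ 2 * i ∸ 1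

insertAt : ℕ → ℤ → List ℤ → List ℤ
insertAt a x σ = take (a ∸ 1) σ ++ x ∷ drop (a ∸ 1) σ

-- builds π recursively: p is the number of letters already processed,
-- σ = π(a_1 ⋯ a_p)
πgo : ℕ → List ℤ → List ℕ → List ℤ
πgo p σ []       = σ
πgo p σ (a ∷ as) = πgo (suc p) (insertAt a (+ suc p) σ ++ [ - (+ suc p) ]) as

π : List ℕ → List ℤ
π w = πgo 0 [] w

ClosedPrefix : List ℤ → ℕ → Set
ClosedPrefix σ t = ∀ x → x ∈ take t σ → (- x) ∈ take t σ

IsFirstComponent : List ℤ → List ℤ → Set
IsFirstComponent σ τ =
  Σ ℕ λ t → 1 ≤ t × ClosedPrefix σ t
          × (∀ t′ → 1 ≤ t′ → t′ < t → ¬ ClosedPrefix σ t′)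
          × τ ≡ take t σ

GoodIndex : ℕ → List ℕ → ℕ → Set
GoodIndex n w k′ = 2 ≤ k′ × k′ ≤ n ∸ 1 × (∀ j → k′ ≤ j → j ≤ n ∸ 1 → 2 * k′ ∸ 1 ≤ entry w j)

IsK : ℕ → List ℕ → ℕ → Set
IsK n w k = (GoodIndex n w k × (∀ k′ → k′ < k → ¬ GoodIndex n w k′))
          ⊎ (k ≡ n × (∀ k′ → ¬ GoodIndex n w k′))

module Submission where

-- The proof rests on three facts about the construction π, developed in turn:
--  * Invariants: π(u) has length 2|u|, its entries are ±1,…,±|u|, and it is
--    closed under negation (every step inserts p and appends -p).
--  * Stability: a letter a only shifts the entries at positions ≥ a, so if all
--    letters after a₁⋯a_K exceed 2K, then π(a₁⋯a_K) is the prefix of length 2K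
--    of π(w); being closed under negation, it is a closed prefix.
--  * Shape of closed prefixes: a closed prefix of π(u) of length t < 2|u| has
--    even length t = 2q and all letters a_j with j > q exceed 2q.  Induction on
--    u: the last letter p = |u| is inserted at position a_p, while -p sits at
--    the very end, so a short closed prefix must end before position a_p and is
--    already a closed prefix of π(a₁⋯a_{p-1}).
-- By the last fact, a shorter closed prefix of π(w) of length 2q would make q+1
-- a good index smaller than k; hence the first component has length 2(k-1).

open import Defs
open import Data.Nat using (ℕ; _≤_; _∸_)
open import Data.List using (List; length; take)
open import Relation.Binary.PropositionalEquality using (_≡_)

open import Data.Nat using (zero; suc; _+_; _*_; _<_; _≤?_; z≤n; s≤s; s≤s⁻¹)
open import Data.Nat.Properties
open import Data.Integer using (ℤ; +_; -_; ∣_∣)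
open import Data.List using ([]; _∷_; _++_; [_]; _∷ʳ_; drop)
open import Data.List.Properties using (length-++; take++drop≡id; take-take; length-take; take-all)
open import Data.List.Reverse using (Reverse; []; _∶_∶ʳ_; reverseView)
open import Data.List.Relation.Unary.Any using (here; there)
open import Data.List.Relation.Unary.All using (All; []; _∷_)
open import Data.List.Membership.Propositional using (_∈_)
open import Data.List.Membership.Propositional.Properties using (∈-++⁻; ∈-++⁺ˡ; ∈-++⁺ʳ; ∈-insert)
open import Data.Product using (Σ; _×_; _,_; proj₁; proj₂)
open import Data.Sum using (_⊎_; inj₁; inj₂)
open import Data.Empty using (⊥-elim)
open import Relation.Nullary using (¬_; yes; no)
open import Relation.Binary.PropositionalEquality using (refl; sym; trans; cong; subst; subst₂; module ≡-Reasoning)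

twice-suc∸1 : ∀ m → 2 * suc m ∸ 1 ≡ suc (2 * m)
twice-suc∸1 m = cong (_∸ 1) (*-suc 2 m)

≤∸1⇒< : ∀ {t a} → 1 ≤ a → t ≤ a ∸ 1 → t < a
≤∸1⇒< {a = suc a} _ le = s≤s le

module _ {A : Set} where

  ∈-inserted⁻ : ∀ {x y : A} xs {ys} → x ∈ xs ++ y ∷ ys → x ≡ y ⊎ x ∈ xs ++ ys
  ∈-inserted⁻ xs m with ∈-++⁻ xs m
  ... | inj₁ m′         = inj₂ (∈-++⁺ˡ m′)
  ... | inj₂ (here e)   = inj₁ e
  ... | inj₂ (there m′) = inj₂ (∈-++⁺ʳ xs m′)

  ∈-inserted⁺ : ∀ {x y : A} xs {ys} → x ∈ xs ++ ys → x ∈ xs ++ y ∷ ys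
  ∈-inserted⁺ xs m with ∈-++⁻ xs m
  ... | inj₁ m′ = ∈-++⁺ˡ m′
  ... | inj₂ m′ = ∈-++⁺ʳ xs (there m′)

  length-inserted : ∀ xs {ys} (y : A) → length (xs ++ y ∷ ys) ≡ suc (length (xs ++ ys))
  length-inserted []       y = refl
  length-inserted (x ∷ xs) y = cong suc (length-inserted xs y)

  ∈-take-inserted : ∀ {y : A} xs ys t → length xs < t → y ∈ take t (xs ++ y ∷ ys)
  ∈-take-inserted []       ys (suc t) _         = here refl
  ∈-take-inserted (x ∷ xs) ys (suc t) (s≤s lt) = there (∈-take-inserted xs ys t lt)

  take-++ˡ : ∀ L (xs ys : List A) → L ≤ length xs → take L (xs ++ ys) ≡ take L xs
  take-++ˡ zero    xs       ys _         = refl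
  take-++ˡ (suc L) (x ∷ xs) ys (s≤s le) = cong (x ∷_) (take-++ˡ L xs ys le)

  take-take-≤ : ∀ t L (xs : List A) → t ≤ L → take t (take L xs) ≡ take t xs
  take-take-≤ t L xs t≤L = trans (take-take t L xs) (cong (λ s → take s xs) (m≤n⇒m⊓n≡m t≤L))

  length-take-≤ : ∀ L (xs : List A) → L ≤ length xs → length (take L xs) ≡ L
  length-take-≤ L xs L≤xs = trans (length-take L xs) (m≤n⇒m⊓n≡m L≤xs)

  ∈-take⁻ : ∀ {x : A} t xs → x ∈ take t xs → x ∈ xs
  ∈-take⁻ t xs m = subst (_ ∈_) (take++drop≡id t xs) (∈-++⁺ˡ m)

length-insertAt : ∀ a y σ → length (insertAt a y σ) ≡ suc (length σ)
length-insertAt a y σ =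
  trans (length-inserted (take (a ∸ 1) σ) y) (cong (λ l → suc (length l)) (take++drop≡id (a ∸ 1) σ))

∈-insertAt⁻ : ∀ {x} a y σ → x ∈ insertAt a y σ → x ≡ y ⊎ x ∈ σ
∈-insertAt⁻ a y σ m with ∈-inserted⁻ (take (a ∸ 1) σ) m
... | inj₁ e  = inj₁ e
... | inj₂ m′ = inj₂ (subst (_ ∈_) (take++drop≡id (a ∸ 1) σ) m′)

∈-insertAt⁺ : ∀ {x} a y σ → x ∈ σ → x ∈ insertAt a y σ
∈-insertAt⁺ a y σ m = ∈-inserted⁺ (take (a ∸ 1) σ) (subst (_ ∈_) (sym (take++drop≡id (a ∸ 1) σ)) m)

take-insertAt : ∀ t a y σ → t ≤ a ∸ 1 → t ≤ length σ → take t (insertAt a y σ) ≡ take t σ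
take-insertAt t a y σ t≤M t≤σ =
  trans (take-++ˡ t (take (a ∸ 1) σ) _ t≤|take|) (take-take-≤ t (a ∸ 1) σ t≤M)
  where
  t≤|take| : t ≤ length (take (a ∸ 1) σ)
  t≤|take| = subst (t ≤_) (sym (length-take (a ∸ 1) σ)) (⊓-glb t≤M t≤σ)

∈-take-insertAt : ∀ t a y σ → a ∸ 1 ≤ length σ → a ∸ 1 < t → y ∈ take t (insertAt a y σ)
∈-take-insertAt t a y σ M≤σ M<t =
  ∈-take-inserted (take (a ∸ 1) σ) _ t
    (subst (_< t) (sym (length-take-≤ (a ∸ 1) σ M≤σ)) M<t)

extend : ℕ → ℕ → List ℤ → List ℤ
extend p a σ = insertAt a (+ suc p) σ ++ [ - (+ suc p) ]

length-extend : ∀ p a σ → length (extend p a σ) ≡ suc (suc (length σ))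
length-extend p a σ = begin
  length (insertAt a y σ ++ [ - y ]) ≡⟨ length-++ (insertAt a y σ) ⟩
  length (insertAt a y σ) + 1        ≡⟨ cong (_+ 1) (length-insertAt a y σ) ⟩
  suc (length σ) + 1                 ≡⟨ +-comm (suc (length σ)) 1 ⟩
  suc (suc (length σ))               ∎
  where
  open ≡-Reasoning
  y = + suc p

∈-extend⁻ : ∀ {x} p a σ → x ∈ extend p a σ → x ≡ + suc p ⊎ x ∈ σ ⊎ x ≡ - (+ suc p)
∈-extend⁻ p a σ m with ∈-++⁻ (insertAt a (+ suc p) σ) m
... | inj₂ (here e) = inj₂ (inj₂ e)
... | inj₁ m′ with ∈-insertAt⁻ a (+ suc p) σ m′
...   | inj₁ e   = inj₁ e
...   | inj₂ m″  = inj₂ (inj₁ m″)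

πgo-invariant : (P : ℕ → List ℤ → Set) → (∀ p a σ → P p σ → P (suc p) (extend p a σ))
              → ∀ {p σ} v → P p σ → P (length v + p) (πgo p σ v)
πgo-invariant P step         []      h = h
πgo-invariant P step {p} {σ} (a ∷ v) h =
  subst (λ q → P q (πgo (suc p) (extend p a σ) v)) (+-suc (length v) p) (πgo-invariant P step v (step p a σ h))

π-invariant : (P : ℕ → List ℤ → Set) → (∀ p a σ → P p σ → P (suc p) (extend p a σ))
            → P 0 [] → ∀ u → P (length u) (π u)
π-invariant P step h0 u = subst (λ q → P q (π u)) (+-identityʳ (length u)) (πgo-invariant P step u h0)

length-π : ∀ u → length (π u) ≡ 2 * length u
length-π = π-invariant (λ p σ → length σ ≡ 2 * p) step refl
  where
  step : ∀ p a σ → length σ ≡ 2 * p → length (extend p a σ) ≡ 2 * suc p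
  step p a σ eq = trans (length-extend p a σ) (trans (cong (λ l → suc (suc l)) eq) (sym (*-suc 2 p)))

bound-π : ∀ u x → x ∈ π u → ∣ x ∣ ≤ length u
bound-π = π-invariant (λ p σ → ∀ x → x ∈ σ → ∣ x ∣ ≤ p) step (λ _ ())
  where
  step : ∀ p a σ → (∀ x → x ∈ σ → ∣ x ∣ ≤ p) → ∀ x → x ∈ extend p a σ → ∣ x ∣ ≤ suc p
  step p a σ h x m with ∈-extend⁻ p a σ m
  ... | inj₁ refl         = ≤-refl
  ... | inj₂ (inj₁ m′)    = m≤n⇒m≤1+n (h x m′)
  ... | inj₂ (inj₂ refl)  = ≤-refl

SignClosed : List ℤ → Set
SignClosed σ = ∀ x → x ∈ σ → - x ∈ σ

closed-π : ∀ u → SignClosed (π u)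
closed-π = π-invariant (λ _ σ → SignClosed σ) step (λ _ ())
  where
  step : ∀ p a σ → SignClosed σ → SignClosed (extend p a σ)
  step p a σ h x m with ∈-extend⁻ p a σ m
  ... | inj₁ refl        = ∈-++⁺ʳ (insertAt a (+ suc p) σ) (here refl)
  ... | inj₂ (inj₁ m′)   = ∈-++⁺ˡ (∈-insertAt⁺ a (+ suc p) σ (h x m′))
  ... | inj₂ (inj₂ refl) = ∈-++⁺ˡ (∈-insert (take (a ∸ 1) σ))

πgo-++ : ∀ p σ xs ys → πgo p σ (xs ++ ys) ≡ πgo (length xs + p) (πgo p σ xs) ys
πgo-++ p σ []       ys = refl
πgo-++ p σ (a ∷ xs) ys rewrite sym (+-suc (length xs) p) = πgo-++ (suc p) (extend p a σ) xs ys

π-++ : ∀ xs ys → π (xs ++ ys) ≡ πgo (length xs) (π xs) ys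
π-++ xs ys = trans (πgo-++ 0 [] xs ys) (cong (λ p → πgo p (π xs) ys) (+-identityʳ (length xs)))

π-snoc : ∀ xs a → π (xs ∷ʳ a) ≡ extend (length xs) a (π xs)
π-snoc xs a = π-++ xs [ a ]

πgo-prefix-stable : ∀ L p σ v → L ≤ length σ → All (λ a → L ≤ a ∸ 1) v → take L (πgo p σ v) ≡ take L σ
πgo-prefix-stable L p σ []      _   []         = refl
πgo-prefix-stable L p σ (a ∷ v) L≤σ (L≤a ∷ ls) = begin
  take L (πgo (suc p) (extend p a σ) v) ≡⟨ πgo-prefix-stable L (suc p) _ v L≤σ′ ls ⟩
  take L (extend p a σ)                 ≡⟨ take-++ˡ L (insertAt a (+ suc p) σ) _ L≤ins ⟩
  take L (insertAt a (+ suc p) σ)       ≡⟨ take-insertAt L a (+ suc p) σ L≤a L≤σ ⟩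
  take L σ                              ∎
  where
  open ≡-Reasoning
  L≤ins : L ≤ length (insertAt a (+ suc p) σ)
  L≤ins = subst (L ≤_) (sym (length-insertAt a (+ suc p) σ)) (m≤n⇒m≤1+n L≤σ)
  L≤σ′ : L ≤ length (extend p a σ)
  L≤σ′ = subst (L ≤_) (sym (length-extend p a σ)) (m≤n⇒m≤1+n (m≤n⇒m≤1+n L≤σ))

π-prefix : ∀ K w → K ≤ length w → All (λ a → 2 * K ≤ a ∸ 1) (drop K w) → take (2 * K) (π w) ≡ π (take K w)
π-prefix K w K≤w large = begin
  take (2 * K) (π w)                    ≡⟨ cong (λ w′ → take (2 * K) (π w′)) (sym (take++drop≡id K w)) ⟩
  take (2 * K) (π (u ++ v))             ≡⟨ cong (take (2 * K)) (π-++ u v) ⟩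
  take (2 * K) (πgo (length u) (π u) v) ≡⟨ πgo-prefix-stable (2 * K) _ (π u) v (≤-reflexive (sym |πu|)) large ⟩
  take (2 * K) (π u)                    ≡⟨ take-all (2 * K) (π u) (≤-reflexive |πu|) ⟩
  π u                                   ∎
  where
  open ≡-Reasoning
  u = take K w
  v = drop K w
  |πu| : length (π u) ≡ 2 * K
  |πu| = trans (length-π u) (cong (2 *_) (length-take-≤ K w K≤w))

entry-++ˡ : ∀ xs ys j → j ≤ length xs → entry (xs ++ ys) j ≡ entry xs j
entry-++ˡ []       []       zero          _        = refl
entry-++ˡ []       (y ∷ ys) zero          _        = refl
entry-++ˡ (x ∷ xs) ys       zero          _        = refl
entry-++ˡ (x ∷ xs) ys       (suc zero)    _        = refl
entry-++ˡ (x ∷ xs) ys       (suc (suc j)) (s≤s le) = entry-++ˡ xs ys (suc j) le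

entry-last : ∀ xs a → entry (xs ∷ʳ a) (suc (length xs)) ≡ a
entry-last []       a = refl
entry-last (x ∷ xs) a = entry-last xs a

length-snoc : ∀ (xs : List ℕ) a → length (xs ∷ʳ a) ≡ suc (length xs)
length-snoc xs a = trans (length-++ xs) (+-comm (length xs) 1)

valid-++ˡ : ∀ xs ys → ValidWord (xs ++ ys) → ValidWord xs
valid-++ˡ xs ys valid i 1≤i i≤xs rewrite sym (entry-++ˡ xs ys i i≤xs) =
  valid i 1≤i (subst (i ≤_) (sym (length-++ xs)) (m≤n⇒m≤n+o (length ys) i≤xs))

entry-take : ∀ K w j → j ≤ K → K ≤ length w → entry (take K w) j ≡ entry w j
entry-take K w j j≤K K≤w =
  trans (sym (entry-++ˡ (take K w) (drop K w) j (subst (j ≤_) (sym (length-take-≤ K w K≤w)) j≤K)))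
        (cong (λ w′ → entry w′ j) (take++drop≡id K w))

all-drop : ∀ (P : ℕ → Set) K w → (∀ j → K < j → j ≤ length w → P (entry w j)) → All P (drop K w)
all-drop P zero    []      h = []
all-drop P zero    (x ∷ w) h = h 1 (s≤s z≤n) (s≤s z≤n) ∷ all-drop P zero w h′
  where
  h′ : ∀ j → 0 < j → j ≤ length w → P (entry w j)
  h′ (suc j) _ le = h (suc (suc j)) (s≤s z≤n) (s≤s le)
all-drop P (suc K) []      h = []
all-drop P (suc K) (x ∷ w) h = all-drop P K w h′
  where
  h′ : ∀ j → K < j → j ≤ length w → P (entry w j)
  h′ (suc j) lt le = h (suc (suc j)) (s≤s lt) (s≤s le)

-- A closed prefix of one step, short enough to miss the appended -(p+1), ends
-- before the inserted p+1 and is therefore a closed prefix of the previous list.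
closedPrefix-extend : ∀ p a σ t → (∀ x → x ∈ σ → ∣ x ∣ ≤ p) → a ∸ 1 ≤ length σ → t ≤ suc (length σ)
                    → ClosedPrefix (extend p a σ) t → t ≤ a ∸ 1 × ClosedPrefix σ t
closedPrefix-extend p a σ t bounded M≤σ t≤X closed = t≤M , subst SignClosed prefix-eq closedX
  where
  y = + suc p
  X = insertAt a y σ
  onX : take t (extend p a σ) ≡ take t X
  onX = take-++ˡ t X [ - y ] (subst (t ≤_) (sym (length-insertAt a y σ)) t≤X)
  closedX : SignClosed (take t X)
  closedX = subst SignClosed onX closed
  -- -y is not an entry of X, so neither y nor -y lies in the prefix.
  y∉prefix : ¬ (y ∈ take t X)
  y∉prefix y∈ with ∈-insertAt⁻ a y σ (∈-take⁻ t X (closedX y y∈))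
  ... | inj₁ ()
  ... | inj₂ -y∈σ = 1+n≰n (bounded (- y) -y∈σ)
  t≤M : t ≤ a ∸ 1
  t≤M with t ≤? a ∸ 1
  ... | yes le = le
  ... | no  gt = ⊥-elim (y∉prefix (∈-take-insertAt t a y σ M≤σ (≰⇒> gt)))
  prefix-eq : take t X ≡ take t σ
  prefix-eq = take-insertAt t a y σ t≤M (≤-trans t≤M M≤σ)

LateLettersExceed : List ℕ → ℕ → Set
LateLettersExceed u t = ∀ j → t < 2 * j → j ≤ length u → suc t ≤ entry u j

late-full : ∀ u → LateLettersExceed u (2 * length u)
late-full u j lt j≤u = ⊥-elim (<⇒≱ (*-cancelˡ-< 2 (length u) j lt) j≤u)

late-snoc : ∀ xs a t → LateLettersExceed xs t → suc t ≤ a → LateLettersExceed (xs ∷ʳ a) t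
late-snoc xs a t late t<a j lt j≤ with m≤n⇒m<n∨m≡n (subst (j ≤_) (length-snoc xs a) j≤)
... | inj₁ (s≤s j≤xs) = subst (suc t ≤_) (sym (entry-++ˡ xs [ a ] j j≤xs)) (late j lt j≤xs)
... | inj₂ refl       = subst (suc t ≤_) (sym (entry-last xs a)) t<a

ShortClosedPrefixShape : List ℕ → Set
ShortClosedPrefixShape u = ∀ t → t < 2 * length u → ClosedPrefix (π u) t
                         → (Σ ℕ λ q → t ≡ 2 * q) × LateLettersExceed u t

-- Induction step: a short closed prefix of π(xs a) ends before the new letter a,
-- so it is a closed prefix of π(xs) -- either short, or all of π(xs).
shape-snoc : ∀ xs a → ValidWord (xs ∷ʳ a) → ShortClosedPrefixShape xs → ShortClosedPrefixShape (xs ∷ʳ a)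
shape-snoc xs a valid shape t t<u closed = by-length (m≤n⇒m<n∨m≡n t≤2m)
  where
  m = length xs
  last-valid : 1 ≤ a × a ≤ suc (2 * m)
  last-valid with valid (suc m) (s≤s z≤n) (≤-reflexive (sym (length-snoc xs a)))
  ... | 1≤a , a≤ = subst (1 ≤_) (entry-last xs a) 1≤a
                 , subst₂ _≤_ (entry-last xs a) (twice-suc∸1 m) a≤
  M≤π : a ∸ 1 ≤ length (π xs)
  M≤π = subst (a ∸ 1 ≤_) (sym (length-π xs)) (∸-monoˡ-≤ 1 (proj₂ last-valid))
  t≤π : t ≤ suc (length (π xs))
  t≤π = subst (t ≤_) (cong suc (sym (length-π xs)))
          (s≤s⁻¹ (subst (t <_) (trans (cong (2 *_) (length-snoc xs a)) (*-suc 2 m)) t<u))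
  before-a : t ≤ a ∸ 1 × ClosedPrefix (π xs) t
  before-a = closedPrefix-extend m a (π xs) t (bound-π xs) M≤π t≤π
               (subst (λ σ → ClosedPrefix σ t) (π-snoc xs a) closed)
  t<a : t < a
  t<a = ≤∸1⇒< (proj₁ last-valid) (proj₁ before-a)
  t≤2m : t ≤ 2 * m
  t≤2m = subst (t ≤_) (length-π xs) (≤-trans (proj₁ before-a) M≤π)
  by-length : t < 2 * m ⊎ t ≡ 2 * m → (Σ ℕ λ q → t ≡ 2 * q) × LateLettersExceed (xs ∷ʳ a) t
  by-length (inj₁ short) with shape t short (proj₂ before-a)
  ... | even , late = even , late-snoc xs a t late t<a
  by-length (inj₂ full) =
    (m , full) , subst (LateLettersExceed (xs ∷ʳ a)) (sym full)
                   (late-snoc xs a (2 * m) (late-full xs) (subst (_< a) full t<a))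

closedPrefix-shape : ∀ u → ValidWord u → ShortClosedPrefixShape u
closedPrefix-shape u = go (reverseView u)
  where
  go : ∀ {u} → Reverse u → ValidWord u → ShortClosedPrefixShape u
  go []               _     t ()
  go (xs ∶ rest ∶ʳ a) valid = shape-snoc xs a valid (go rest (valid-++ˡ xs [ a ] valid))

goodIndex-from-prefix : ∀ n w K q → 1 ≤ q → q < K → K ≤ n ∸ 1 → K ≤ length w
  → LateLettersExceed (take K w) (2 * q)
  → (∀ j → suc K ≤ j → j ≤ n ∸ 1 → 2 * suc K ∸ 1 ≤ entry w j)
  → GoodIndex n w (suc q)
goodIndex-from-prefix n w K q 1≤q q<K K≤n K≤w late tail = s≤s 1≤q , ≤-trans q<K K≤n , large
  where
  large : ∀ j → suc q ≤ j → j ≤ n ∸ 1 → 2 * suc q ∸ 1 ≤ entry w j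
  large j q<j j≤n rewrite twice-suc∸1 q with j ≤? K
  ... | yes j≤K = subst (suc (2 * q) ≤_) (entry-take K w j j≤K K≤w)
                    (late j (*-monoʳ-< 2 q<j) (subst (j ≤_) (sym (length-take-≤ K w K≤w)) j≤K))
  ... | no  j≰K = ≤-trans (s≤s (*-monoʳ-≤ 2 (<⇒≤ q<K)))
                    (subst (_≤ entry w j) (twice-suc∸1 K) (tail j (≰⇒> j≰K) j≤n))

firstComponent : ∀ n w K → length w ≡ n ∸ 1 → ValidWord w → 1 ≤ K → K ≤ n ∸ 1
  → (∀ j → suc K ≤ j → j ≤ n ∸ 1 → 2 * suc K ∸ 1 ≤ entry w j)
  → (∀ k′ → k′ < suc K → ¬ GoodIndex n w k′)
  → IsFirstComponent (π w) (π (take K w))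
firstComponent n w K |w| valid 1≤K K≤n tail least = 2 * K , 1≤2K , closed , minimal , sym prefix
  where
  u = take K w
  K≤w : K ≤ length w
  K≤w = subst (K ≤_) (sym |w|) K≤n
  1≤2K : 1 ≤ 2 * K
  1≤2K = ≤-trans 1≤K (m≤m+n K (K + 0))
  tail-large : All (λ a → 2 * K ≤ a ∸ 1) (drop K w)
  tail-large = all-drop _ K w λ j K<j j≤w →
    ∸-monoˡ-≤ 1 (subst (_≤ entry w j) (twice-suc∸1 K) (tail j K<j (subst (j ≤_) |w| j≤w)))
  prefix : take (2 * K) (π w) ≡ π u
  prefix = π-prefix K w K≤w tail-large
  closed : ClosedPrefix (π w) (2 * K)
  closed = subst SignClosed (sym prefix) (closed-π u)
  valid-u : ValidWord u
  valid-u = valid-++ˡ u (drop K w) (subst ValidWord (sym (take++drop≡id K w)) valid)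
  -- A shorter closed prefix of π(w) is one of π(u), hence of length 2q with
  -- q+1 a good index below K+1.
  minimal : ∀ t → 1 ≤ t → t < 2 * K → ¬ ClosedPrefix (π w) t
  minimal t 1≤t t<2K cp
    with closedPrefix-shape u valid-u t (subst (λ k → t < 2 * k) (sym (length-take-≤ K w K≤w)) t<2K)
           (subst SignClosed (trans (sym (take-take-≤ t (2 * K) (π w) (<⇒≤ t<2K))) (cong (take t) prefix)) cp)
  ... | (zero  , refl) , _    = 1+n≰n 1≤t
  ... | (suc q , refl) , late =
    least (suc (suc q)) (s≤s q<K) (goodIndex-from-prefix n w K (suc q) (s≤s z≤n) q<K K≤n K≤w late tail)
    where
    q<K : suc q < K
    q<K = *-cancelˡ-< 2 (suc q) K t<2K

-- Either k is the least good index, or there is none and k = n; in both cases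
-- the letters after position k - 1 are large and no smaller index is good.
lemma5p8 : (n : ℕ) → 2 ≤ n → (w : List ℕ) → length w ≡ n ∸ 1 → ValidWord w → (k : ℕ) → IsK n w k → IsFirstComponent (π w) (π (take (k ∸ 1) w))
lemma5p8 n _   w |w| valid zero    (inj₁ ((() , _) , _))
lemma5p8 n ()  w |w| valid zero    (inj₂ (refl , _))
lemma5p8 n _   w |w| valid (suc K) (inj₁ ((2≤k , k≤n , tail) , least)) =
  firstComponent n w K |w| valid (s≤s⁻¹ 2≤k) (<⇒≤ k≤n) tail least
lemma5p8 _ 2≤n w |w| valid (suc K) (inj₂ (refl , none)) =
  firstComponent (suc K) w K |w| valid (s≤s⁻¹ 2≤n) ≤-refl
    (λ j K<j j≤K → ⊥-elim (<⇒≱ K<j j≤K)) (λ k′ _ → none k′)
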